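{- Let $(B_n)_{n\ge0}$ be the balancing numbers. Let $(a,b,c,d)\in\{(1,1,1,1),(1,1,1,3),(1,1,2,2),(1,1,2,4),(1,1,5,5),(1,2,3,6)\}$. If $(x,y,z)=(B_i,B_j,B_k)$ with integers $i,j,k\ge1$ is a solution of $ax^2+by^2+cz^2=dxyz$, then $x=y=z=B_1=1$. (That is, there is at most one such solution, namely $(1,1,1)$.)
   Context: The balancing numbers are defined by $B_0=0$, $B_1=1$, $B_n=6B_{n-1}-B_{n-2}$ for $n\ge2$. -}

module Defs where

open import Data.Nat using (ℕ; zero; suc; _*_; _∸_)
open import Data.Product using (_×_; _,_)
open import Data.List using (List; []; _∷_)

-- Balancing numbers: B 0 = 0, B 1 = 1, B (n+2) = 6 B (n+1) - B n.
-- The truncated subtraction never truncates here since B is non-decreasing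
-- and nonnegative (6 B(n+1) ≥ B n).
B : ℕ → ℕ
B zero = 0
B (suc zero) = 1
B (suc (suc n)) = 6 * B (suc n) ∸ B n

coeffTuples : List (ℕ × ℕ × ℕ × ℕ)
coeffTuples =
  (1 , 1 , 1 , 1) ∷ (1 , 1 , 1 , 3) ∷ (1 , 1 , 2 , 2) ∷
  (1 , 1 , 2 , 4) ∷ (1 , 1 , 5 , 5) ∷ (1 , 2 , 3 , 6) ∷ []

-- Sort the indices so that i ≤ j ≤ k and put u = B i, v = B j.  The equation is then
-- q(B k) = 0 for the quadratic q(z) = c z² − d u v z + (a u² + b v²), whose larger root is
-- close to (d / c) u v.  Balancing numbers grow by a factor 3 + 2√2 and obey the addition
-- formula B (m + n) + B (m − 1) B (n − 1) = B m B n, so for i ≥ 2 that root falls strictly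
-- between two consecutive balancing numbers B n < B (n + 1): q < 0 at B j and at B n, and
-- q > 0 and increasing from B (n + 1) on.  The right n depends only on d / c.  For i = 1
-- the same comparison at B (j + 1), using B (j + 1)² − 6 B (j + 1) B j + B j² = 1, together
-- with a remainder argument at k = j, forces j = 1, and then q > 0 beyond B 2 forces B k = 1.
module Submission where

open import Defs
open import Data.Nat using (ℕ; zero; suc; _+_; _*_; _∸_; _≤_; _<_; _≥_; z≤n; s≤s; z<s; _≤?_; _<?_; _≟_; NonZero; >-nonZero)
open import Data.Nat.DivMod using (_%_; [m+kn]%n≡m%n; m*n%n≡0; m<n⇒m%n≡m)
open import Data.Nat.Properties
open import Data.Nat.Tactic.RingSolver using (solve-∀; solve)
open import Data.List using ([]; _∷_)
open import Data.Product using (_×_; _,_)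
open import Data.Sum using (inj₁; inj₂)
open import Data.Empty using (⊥-elim)
open import Data.List.Membership.Propositional using (_∈_)
open import Data.List.Relation.Unary.Any using (here; there)
open import Relation.Binary.PropositionalEquality
open import Relation.Nullary using (¬_; yes; no)
open import Relation.Nullary.Decidable using (Dec; True; toWitness; from-yes; _×-dec_)

5*m≤6*m∸n : ∀ {m n} → n ≤ m → 5 * m ≤ 6 * m ∸ n
5*m≤6*m∸n {m} {n} n≤m = subst (5 * m ≤_) (sym (+-∸-comm (5 * m) n≤m)) (m≤n+m (5 * m) (m ∸ n))

+-≡-flip-< : ∀ {a x b y} → a + x ≡ b + y → a < b → y < x
+-≡-flip-< eq a<b = ≰⇒> λ x≤y → <-irrefl eq (+-mono-<-≤ a<b x≤y)

<-*⇒1≤ : ∀ {m} n {c} → m < n * c → 1 ≤ c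
<-*⇒1≤ {m} n {zero} m<n*0 = ⊥-elim (n≮0 (subst (m <_) (*-zeroʳ n) m<n*0))
<-*⇒1≤ n {suc c} _ = s≤s z≤n

scale-shift-≤ : ∀ c m {d x U} → d ≤ m * c → m * x ≤ U → d * x ≤ c * U
scale-shift-≤ c m {d} {x} {U} d≤mc mx≤U = begin
  d * x        ≤⟨ *-monoˡ-≤ x d≤mc ⟩
  m * c * x    ≡⟨ cong (_* x) (*-comm m c) ⟩
  c * m * x    ≡⟨ *-assoc c m x ⟩
  c * (m * x)  ≤⟨ *-monoʳ-≤ c mx≤U ⟩
  c * U        ∎
  where open ≤-Reasoning

square-nonZero : ∀ {v} → 1 ≤ v → NonZero (v * v)
square-nonZero 1≤v = >-nonZero (*-mono-≤ 1≤v 1≤v)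

+-*-≢-* : ∀ {r s} m n → 0 < r → r < s → r + m * s ≢ n * s
+-*-≢-* {r} {s} m n 0<r r<s eq = <⇒≢ 0<r (begin
  0                  ≡⟨ sym (m*n%n≡0 n s) ⟩
  (n * s) % s        ≡⟨ cong (_% s) (sym eq) ⟩
  (r + m * s) % s    ≡⟨ [m+kn]%n≡m%n r m s ⟩
  r % s              ≡⟨ m<n⇒m%n≡m r<s ⟩
  r                  ∎)
  where
  open ≡-Reasoning
  instance
    s≢0 : NonZero s
    s≢0 = >-nonZero (<-trans 0<r r<s)

-- Balancing numbers

B-growth : ∀ n → 5 * B n ≤ B (suc n)
B-growth zero = z≤n
B-growth (suc zero) = from-yes (5 ≤? 6)
B-growth (suc (suc n)) = 5*m≤6*m∸n (≤-trans (m≤n*m (B (suc n)) 5) (B-growth (suc n)))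

B-step : ∀ n → B n ≤ B (suc n)
B-step n = ≤-trans (m≤n*m (B n) 5) (B-growth n)

B-recurrence : ∀ n → B (suc (suc n)) + B n ≡ 6 * B (suc n)
B-recurrence n = m∸n+n≡m (≤-trans (B-step n) (m≤n*m (B (suc n)) 6))

B-suc≤6*B : ∀ {n} → 1 ≤ n → B (suc n) ≤ 6 * B n
B-suc≤6*B {suc n} _ = m∸n≤m (6 * B (suc n)) (B n)

B-≤-+ : ∀ m δ → B m ≤ B (δ + m)
B-≤-+ m zero = ≤-refl
B-≤-+ m (suc δ) = ≤-trans (B-≤-+ m δ) (B-step (δ + m))

B-mono-≤ : ∀ {m n} → m ≤ n → B m ≤ B n
B-mono-≤ {m} {n} m≤n = subst (λ t → B m ≤ B t) (m∸n+n≡m m≤n) (B-≤-+ m (n ∸ m))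

6*B≤B-suc+B-suc : ∀ n → 6 * B n ≤ B (suc n) + B (suc n)
6*B≤B-suc+B-suc n = +-mono-≤ (≤-trans (m≤n*m (B n) 5) (B-growth n)) (B-growth n)

6*B≤B-suc-suc : ∀ n → 6 * B n ≤ B (suc (suc n))
6*B≤B-suc-suc n = begin
  6 * B n            ≤⟨ *-monoˡ-≤ (B n) (from-yes (6 ≤? 25)) ⟩
  25 * B n           ≡⟨ *-assoc 5 5 (B n) ⟩
  5 * (5 * B n)      ≤⟨ *-monoʳ-≤ 5 (B-growth n) ⟩
  5 * B (suc n)      ≤⟨ B-growth (suc n) ⟩
  B (suc (suc n))    ∎
  where open ≤-Reasoning

36≤B*B : ∀ {j} → 2 ≤ j → 36 ≤ B j * B j
36≤B*B 2≤j = *-mono-≤ (B-mono-≤ 2≤j) (B-mono-≤ 2≤j)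

invariant⇒cassini : ∀ x y z → x + z ≡ 6 * y → y * y + z * z ≡ 6 * y * z + 1 → y * y ≡ 1 + x * z
invariant⇒cassini x y z rec inv = +-cancelʳ-≡ (6 * y * z) (y * y) (1 + x * z) (begin
  y * y + 6 * y * z        ≡⟨ cong (λ t → y * y + t * z) (sym rec) ⟩
  y * y + (x + z) * z      ≡⟨ solve (x ∷ y ∷ z ∷ []) ⟩
  (y * y + z * z) + x * z  ≡⟨ cong (_+ x * z) inv ⟩
  (6 * y * z + 1) + x * z  ≡⟨ solve (x ∷ y ∷ z ∷ []) ⟩
  1 + x * z + 6 * y * z    ∎)
  where open ≡-Reasoning

cassini⇒invariant : ∀ x y z → x + z ≡ 6 * y → y * y ≡ 1 + x * z → x * x + y * y ≡ 6 * x * y + 1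
cassini⇒invariant x y z rec cas = begin
  x * x + y * y        ≡⟨ cong (x * x +_) cas ⟩
  x * x + (1 + x * z)  ≡⟨ solve (x ∷ y ∷ z ∷ []) ⟩
  x * (x + z) + 1      ≡⟨ cong (λ t → x * t + 1) rec ⟩
  x * (6 * y) + 1      ≡⟨ solve (x ∷ y ∷ z ∷ []) ⟩
  6 * x * y + 1        ∎
  where open ≡-Reasoning

B-invariant : ∀ n → B (suc n) * B (suc n) + B n * B n ≡ 6 * B (suc n) * B n + 1
B-invariant zero = refl
B-invariant (suc n) = cassini⇒invariant x y z (B-recurrence n) (invariant⇒cassini x y z (B-recurrence n) (B-invariant n))
  where
  x = B (suc (suc n))
  y = B (suc n)
  z = B n

recurrence-unique : ∀ {p₀ p₁ p₂ q₀ q₁ q₂} → p₂ + p₀ ≡ 6 * p₁ → q₂ + q₀ ≡ 6 * q₁ →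
  p₀ ≡ q₀ → p₁ ≡ q₁ → p₂ ≡ q₂
recurrence-unique {p₀} {p₂ = p₂} {q₂ = q₂} p-rec q-rec refl refl =
  +-cancelʳ-≡ p₀ p₂ q₂ (trans p-rec (sym q-rec))

recurrence-combination : ∀ x₀ x₁ x₂ y₀ y₁ y₂ r → x₂ + x₀ ≡ 6 * x₁ → y₂ + y₀ ≡ 6 * y₁ →
  (x₂ + y₂ * r) + (x₀ + y₀ * r) ≡ 6 * (x₁ + y₁ * r)
recurrence-combination x₀ x₁ x₂ y₀ y₁ y₂ r x-rec y-rec = begin
  (x₂ + y₂ * r) + (x₀ + y₀ * r)  ≡⟨ solve (x₀ ∷ x₂ ∷ y₀ ∷ y₂ ∷ r ∷ []) ⟩
  (x₂ + x₀) + (y₂ + y₀) * r      ≡⟨ cong₂ (λ s t → s + t * r) x-rec y-rec ⟩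
  6 * x₁ + 6 * y₁ * r            ≡⟨ solve (x₁ ∷ y₁ ∷ r ∷ []) ⟩
  6 * (x₁ + y₁ * r)              ∎
  where open ≡-Reasoning

recurrence-scale : ∀ y₀ y₁ y₂ r → y₂ + y₀ ≡ 6 * y₁ → y₂ * r + y₀ * r ≡ 6 * (y₁ * r)
recurrence-scale y₀ y₁ y₂ r y-rec = begin
  y₂ * r + y₀ * r  ≡⟨ sym (*-distribʳ-+ r y₂ y₀) ⟩
  (y₂ + y₀) * r    ≡⟨ cong (_* r) y-rec ⟩
  6 * y₁ * r       ≡⟨ *-assoc 6 y₁ r ⟩
  6 * (y₁ * r)     ∎
  where open ≡-Reasoning

-- Both sides satisfy the balancing recurrence in m.
B-addition : ∀ m n → B (suc m + n) + B m * B n ≡ B (suc m) * B (suc n)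
B-addition zero n = refl
B-addition (suc zero) n = trans (cong (B (suc (suc n)) +_) (+-identityʳ (B n))) (B-recurrence n)
B-addition (suc (suc m)) n =
  recurrence-unique
    (recurrence-combination (B (suc m + n)) (B (suc (suc m) + n)) (B (suc (suc (suc m)) + n))
      (B m) (B (suc m)) (B (suc (suc m))) (B n) (B-recurrence (suc m + n)) (B-recurrence m))
    (recurrence-scale (B (suc m)) (B (suc (suc m))) (B (suc (suc (suc m)))) (B (suc n)) (B-recurrence (suc m)))
    (B-addition m n) (B-addition (suc m) n)

product-bound : ∀ {L x₀ x y v w} → L + x * v ≡ y * w → y + x₀ ≡ 6 * x → 5 * x₀ ≤ x → 5 * v ≤ w →
  5 * (x * w) ≤ L
product-bound {L} {x₀} {x} {y} {v} {w} add rec 5x₀≤x 5v≤w =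
  +-cancelʳ-≤ (x₀ * w + x * v) (5 * (x * w)) L (begin
    5 * (x * w) + (x₀ * w + x * v)  ≤⟨ +-monoʳ-≤ (5 * (x * w)) cross-terms≤ ⟩
    5 * (x * w) + x * w             ≡⟨ solve (x ∷ w ∷ []) ⟩
    (6 * x) * w                     ≡⟨ cong (_* w) (sym rec) ⟩
    (y + x₀) * w                    ≡⟨ *-distribʳ-+ w y x₀ ⟩
    y * w + x₀ * w                  ≡⟨ cong (_+ x₀ * w) (sym add) ⟩
    L + x * v + x₀ * w              ≡⟨ solve (L ∷ x ∷ v ∷ x₀ ∷ w ∷ []) ⟩
    L + (x₀ * w + x * v)            ∎)
  where
  open ≤-Reasoning
  cross-terms≤ : x₀ * w + x * v ≤ x * w
  cross-terms≤ = *-cancelˡ-≤ 5 (begin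
    5 * (x₀ * w + x * v)        ≡⟨ solve (x₀ ∷ w ∷ x ∷ v ∷ []) ⟩
    (5 * x₀) * w + x * (5 * v)  ≤⟨ +-mono-≤ (*-monoˡ-≤ w 5x₀≤x) (*-monoʳ-≤ x 5v≤w) ⟩
    x * w + x * w               ≤⟨ +-monoʳ-≤ (x * w) (m≤n*m (x * w) 4) ⟩
    x * w + 4 * (x * w)         ≡⟨⟩
    5 * (x * w)                 ∎)

B-product : ∀ m n → 5 * (B (suc m) * B (suc n)) ≤ B (suc (suc m + n))
B-product m n = product-bound {x₀ = B m} (B-addition (suc m) n) (B-recurrence m) (B-growth m) (B-growth n)

-- The sign of a quadratic at balancing numbers

quadratic-step : ∀ c K p t → c * ((p + t) * (p + t)) + K ≡ (c * (p * p) + K) + c * (p + (p + t)) * t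
quadratic-step = solve-∀

-- For q(t) = c t² − D t + K: comparing q at two points p ≤ m locates the
-- vertex D / 2c relative to the midpoint (p + m) / 2.
vertex<midpoint : ∀ c K D {p m} → p ≤ m → c * (p * p) + K < D * p → c * (m * m) + K ≡ D * m →
  D < c * (p + m)
vertex<midpoint c K D {p} p≤m negative root with m≤n⇒∃[o]m+o≡n p≤m
... | t , refl = *-cancelʳ-< t D (c * (p + (p + t)))
  (+-≡-flip-< (trans (sym (quadratic-step c K p t)) (trans root (*-distribˡ-+ D p t))) negative)

midpoint<vertex : ∀ c K D {p m} → p ≤ m → D * p < c * (p * p) + K → c * (m * m) + K ≡ D * m →
  c * (p + m) < D
midpoint<vertex c K D {p} p≤m positive root with m≤n⇒∃[o]m+o≡n p≤m
... | t , refl = *-cancelʳ-< t (c * (p + (p + t))) D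
  (+-≡-flip-< (trans (sym (*-distribˡ-+ D p t)) (trans (sym root) (quadratic-step c K p t))) positive)

midpoint<vertex-of-negative : ∀ c K D {m r} → m ≤ r → c * (m * m) + K ≡ D * m →
  c * (r * r) + K < D * r → c * (m + r) < D
midpoint<vertex-of-negative c K D {m} m≤r root negative with m≤n⇒∃[o]m+o≡n m≤r
... | s , refl = *-cancelʳ-< s (c * (m + (m + s))) D (+-cancelˡ-< (D * m) _ (D * s) (begin-strict
  D * m + c * (m + (m + s)) * s          ≡⟨ cong (_+ c * (m + (m + s)) * s) (sym root) ⟩
  c * (m * m) + K + c * (m + (m + s)) * s ≡⟨ sym (quadratic-step c K m s) ⟩
  c * ((m + s) * (m + s)) + K            <⟨ negative ⟩
  D * (m + s)                            ≡⟨ *-distribˡ-+ D m s ⟩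
  D * m + D * s                          ∎))
  where open ≤-Reasoning

no-root-between-negatives : ∀ c K D {p m r} → p ≤ m → m ≤ r →
  c * (p * p) + K < D * p → c * (r * r) + K < D * r → c * (m * m) + K ≢ D * m
no-root-between-negatives c K D {p} {m} {r} p≤m m≤r negative-p negative-r root = <-irrefl refl (begin-strict
  D            <⟨ vertex<midpoint c K D p≤m negative-p root ⟩
  c * (p + m)  ≤⟨ *-monoʳ-≤ c (+-mono-≤ p≤m m≤r) ⟩
  c * (m + r)  <⟨ midpoint<vertex-of-negative c K D m≤r root negative-r ⟩
  D            ∎)
  where open ≤-Reasoning

no-root-beyond-vertex : ∀ c K D {p m} → p ≤ m → D * p < c * (p * p) + K → D ≤ c * (p + p) →
  c * (m * m) + K ≢ D * m
no-root-beyond-vertex c K D {p} {m} p≤m positive vertex≤p root = <-irrefl refl (begin-strict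
  c * (p + m)  <⟨ midpoint<vertex c K D p≤m positive root ⟩
  D            ≤⟨ vertex≤p ⟩
  c * (p + p)  ≤⟨ *-monoʳ-≤ c (+-monoʳ-≤ p p≤m) ⟩
  c * (p + m)  ∎)
  where open ≤-Reasoning

no-balancing-root : ∀ c K D {j k n} → j ≤ k → j ≤ n →
  c * (B j * B j) + K < D * B j → c * (B n * B n) + K < D * B n →
  D * B (suc n) < c * (B (suc n) * B (suc n)) + K → D ≤ c * (B (suc n) + B (suc n)) →
  c * (B k * B k) + K ≢ D * B k
no-balancing-root c K D {k = k} {n} j≤k j≤n negative-j negative-n positive vertex with k ≤? n
... | yes k≤n = no-root-between-negatives c K D (B-mono-≤ j≤k) (B-mono-≤ k≤n) negative-j negative-n
... | no k≰n = no-root-beyond-vertex c K D (B-mono-≤ (≰⇒> k≰n)) positive vertex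

no-balancing-root-dominated : ∀ c K D {j k n} → j ≤ k → j ≤ n →
  c * (B j * B j) + K < D * B j → c * (B n * B n) + K < D * B n →
  D ≤ c * B (suc n) → 1 ≤ K → c * (B k * B k) + K ≢ D * B k
no-balancing-root-dominated c K D {n = n} j≤k j≤n negative-j negative-n D≤cU 1≤K =
  no-balancing-root c K D j≤k j≤n negative-j negative-n positive (≤-trans D≤cU (*-monoʳ-≤ c (m≤m+n U U)))
  where
  U = B (suc n)
  positive : D * U < c * (U * U) + K
  positive = begin-strict
    D * U            ≤⟨ *-monoˡ-≤ U D≤cU ⟩
    c * U * U        ≡⟨ *-assoc c U U ⟩
    c * (U * U)      <⟨ m<m+n (c * (U * U)) 1≤K ⟩
    c * (U * U) + K  ∎
    where open ≤-Reasoning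

-- The equation as a quadratic in its largest unknown

Solves : ℕ → ℕ → ℕ → ℕ → ℕ → ℕ → ℕ → Set
Solves a b c d x y z = a * (x * x) + b * (y * y) + c * (z * z) ≡ d * (x * y * z)

quadratic-in-z : ∀ a b c d x y z → Solves a b c d x y z →
  c * (z * z) + (a * (x * x) + b * (y * y)) ≡ d * (x * y) * z
quadratic-in-z a b c d x y z eq = begin
  c * (z * z) + (a * (x * x) + b * (y * y))  ≡⟨ solve (a ∷ b ∷ c ∷ x ∷ y ∷ z ∷ []) ⟩
  a * (x * x) + b * (y * y) + c * (z * z)    ≡⟨ eq ⟩
  d * (x * y * z)                            ≡⟨ sym (*-assoc d (x * y) z) ⟩
  d * (x * y) * z                            ∎
  where open ≡-Reasoning

weighted-squares≤ : ∀ a b u v → u ≤ v → a * (u * u) + b * (v * v) ≤ (a + b) * (v * v)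
weighted-squares≤ a b u v u≤v = begin
  a * (u * u) + b * (v * v)  ≤⟨ +-monoˡ-≤ (b * (v * v)) (*-monoʳ-≤ a (*-mono-≤ u≤v u≤v)) ⟩
  a * (v * v) + b * (v * v)  ≡⟨ sym (*-distribʳ-+ (v * v) a b) ⟩
  (a + b) * (v * v)          ∎
  where open ≤-Reasoning

weighted-squares-positive : ∀ a b u v → 1 ≤ a → 1 ≤ u → 1 ≤ a * (u * u) + b * (v * v)
weighted-squares-positive a b u v 1≤a 1≤u = ≤-trans (*-mono-≤ 1≤a (*-mono-≤ 1≤u 1≤u)) (m≤m+n _ _)

negative-at-middle : ∀ a b c d u v → 6 ≤ u → u ≤ v → a + b + c < 6 * d →
  c * (v * v) + (a * (u * u) + b * (v * v)) < d * (u * v) * v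
negative-at-middle a b c d u v 6≤u u≤v abc<6d = begin-strict
  c * (v * v) + (a * (u * u) + b * (v * v))  ≤⟨ +-monoʳ-≤ (c * (v * v)) (weighted-squares≤ a b u v u≤v) ⟩
  c * (v * v) + (a + b) * (v * v)            ≡⟨ solve (a ∷ b ∷ c ∷ v ∷ []) ⟩
  (a + b + c) * (v * v)                      <⟨ *-monoˡ-< (v * v) abc<6d ⟩
  6 * d * (v * v)                            ≡⟨ solve (d ∷ v ∷ []) ⟩
  d * (6 * v) * v                            ≤⟨ *-monoˡ-≤ v (*-monoʳ-≤ d (*-monoˡ-≤ v 6≤u)) ⟩
  d * (u * v) * v                            ∎
  where
  open ≤-Reasoning
  instance
    v²≢0 : NonZero (v * v)
    v²≢0 = square-nonZero (≤-trans (s≤s z≤n) (≤-trans 6≤u u≤v))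

-- Solutions with B i = 1

LowConditions : ℕ → ℕ → ℕ → ℕ → Set
LowConditions a b c d = 1 ≤ a × a < 36 × d ≤ 6 * c × c ≤ 5 * (6 * c ∸ d) + b

low-conditions? : ∀ a b c d → Dec (LowConditions a b c d)
low-conditions? a b c d = 1 ≤? a ×-dec a <? 36 ×-dec d ≤? 6 * c ×-dec c ≤? 5 * (6 * c ∸ d) + b

root-of-Solves-1-1 : ∀ a b c d z → Solves a b c d 1 1 z → c * (z * z) + (a + b) ≡ d * z
root-of-Solves-1-1 a b c d z eq = subst₂ (λ K D → c * (z * z) + K ≡ D * z)
  (cong₂ _+_ (*-identityʳ a) (*-identityʳ b)) (*-identityʳ d)
  (quadratic-in-z a b c d 1 1 z eq)

Solves-1-1⇒B≡1 : ∀ {a b c d k} → LowConditions a b c d → 1 ≤ k → Solves a b c d 1 1 (B k) → B k ≡ 1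
Solves-1-1⇒B≡1 {k = suc zero} _ _ _ = refl
Solves-1-1⇒B≡1 {a} {b} {c} {d} {suc (suc k)} (1≤a , _ , d≤6c , _) _ eq =
  ⊥-elim (no-root-beyond-vertex c (a + b) d (B-mono-≤ {2} {suc (suc k)} (s≤s (s≤s z≤n))) positive vertex
    (root-of-Solves-1-1 a b c d (B (suc (suc k))) eq))
  where
  positive : d * 6 < c * 36 + (a + b)
  positive = begin-strict
    d * 6             ≤⟨ *-monoˡ-≤ 6 d≤6c ⟩
    6 * c * 6         ≡⟨ solve (c ∷ []) ⟩
    c * 36            <⟨ m<m+n (c * 36) (≤-trans 1≤a (m≤m+n a b)) ⟩
    c * 36 + (a + b)  ∎
    where open ≤-Reasoning
  vertex : d ≤ c * (6 + 6)
  vertex = ≤-trans d≤6c (≤-trans (≤-reflexive (*-comm 6 c)) (*-monoʳ-≤ c (m≤m+n 6 6)))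

positive-at-successor : ∀ a b c d e v U → U * U + v * v ≡ 6 * U * v + 1 → 5 * v ≤ U → d + e ≡ 6 * c →
  c ≤ 5 * e + b → 1 ≤ a → d * v * U < c * (U * U) + (a + b * (v * v))
positive-at-successor a b c d e v U invariant 5v≤U d+e≡6c c≤5e+b 1≤a =
  +-cancelʳ-< (c * (v * v)) (d * v * U) (c * (U * U) + (a + b * (v * v))) (begin-strict
    d * v * U + c * (v * v)                            ≤⟨ +-monoʳ-≤ (d * v * U) cv²≤ ⟩
    d * v * U + (e * (U * v) + b * (v * v))            <⟨ m<m+n _ (≤-trans 1≤a (m≤n+m a c)) ⟩
    d * v * U + (e * (U * v) + b * (v * v)) + (c + a)  ≡⟨ solve (d ∷ v ∷ U ∷ e ∷ b ∷ c ∷ a ∷ []) ⟩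
    (d + e) * (U * v) + c + (a + b * (v * v))          ≡⟨ cong (λ t → t * (U * v) + c + (a + b * (v * v))) d+e≡6c ⟩
    6 * c * (U * v) + c + (a + b * (v * v))            ≡⟨ solve (c ∷ U ∷ v ∷ a ∷ b ∷ []) ⟩
    c * (6 * U * v + 1) + (a + b * (v * v))            ≡⟨ cong (λ t → c * t + (a + b * (v * v))) (sym invariant) ⟩
    c * (U * U + v * v) + (a + b * (v * v))            ≡⟨ solve (c ∷ U ∷ v ∷ a ∷ b ∷ []) ⟩
    c * (U * U) + (a + b * (v * v)) + c * (v * v)      ∎)
  where
  open ≤-Reasoning
  cv²≤ : c * (v * v) ≤ e * (U * v) + b * (v * v)
  cv²≤ = begin
    c * (v * v)                      ≤⟨ *-monoˡ-≤ (v * v) c≤5e+b ⟩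
    (5 * e + b) * (v * v)            ≡⟨ solve (e ∷ b ∷ v ∷ []) ⟩
    e * (5 * v * v) + b * (v * v)    ≤⟨ +-monoˡ-≤ (b * (v * v)) (*-monoʳ-≤ e (*-monoˡ-≤ v 5v≤U)) ⟩
    e * (U * v) + b * (v * v)        ∎

root-of-Solves-1 : ∀ a b c d v z → Solves a b c d 1 v z → c * (z * z) + (a + b * (v * v)) ≡ d * v * z
root-of-Solves-1 a b c d v z eq = subst₂ (λ K D → c * (z * z) + K ≡ D * z)
  (cong (_+ b * (v * v)) (*-identityʳ a)) (cong (d *_) (*-identityˡ v))
  (quadratic-in-z a b c d 1 v z eq)

no-root-at-square : ∀ a b c d s → 0 < a → a < s → c * s + (a + b * s) ≢ d * s
no-root-at-square a b c d s 0<a a<s eq = +-*-≢-* (c + b) d 0<a a<s (begin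
  a + (c + b) * s      ≡⟨ solve (a ∷ b ∷ c ∷ s ∷ []) ⟩
  c * s + (a + b * s)  ≡⟨ eq ⟩
  d * s                ∎)
  where open ≡-Reasoning

Solves-1⇒⊥ : ∀ {a b c d j k} → LowConditions a b c d → 2 ≤ j → j ≤ k → ¬ Solves a b c d 1 (B j) (B k)
Solves-1⇒⊥ {a} {b} {c} {d} {j} {k} (1≤a , a<36 , d≤6c , c≤5e+b) 2≤j j≤k eq with m≤n⇒m<n∨m≡n j≤k
... | inj₁ j<k = no-root-beyond-vertex c (a + b * (v * v)) (d * v) (B-mono-≤ j<k)
  (positive-at-successor a b c d (6 * c ∸ d) v U (B-invariant j) (B-growth j) (m+[n∸m]≡n d≤6c) c≤5e+b 1≤a)
  vertex (root-of-Solves-1 a b c d v (B k) eq)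
  where
  v = B j
  U = B (suc j)
  vertex : d * v ≤ c * (U + U)
  vertex = scale-shift-≤ c 6 d≤6c (6*B≤B-suc+B-suc j)
... | inj₂ refl = no-root-at-square a b c d (B j * B j) (≤-trans (s≤s z≤n) 1≤a) (<-≤-trans a<36 (36≤B*B 2≤j))
  (trans (root-of-Solves-1 a b c d (B j) (B j) eq) (*-assoc d (B j) (B j)))

-- No solutions with i ≥ 2

NoSolutionFrom : ℕ → ℕ → ℕ → ℕ → ℕ → Set
NoSolutionFrom n a b c d = ∀ {i j k} → n ≤ i → i ≤ j → j ≤ k → ¬ Solves a b c d (B i) (B j) (B k)

-- L + w = u v is the addition formula B (i + j − 1) + B (i − 1) B (j − 1) = B i B j.
negative-below-product : ∀ a b c d u v L w → L + w ≡ u * v → c < d → 6 ≤ u → u ≤ v → 5 * v ≤ L →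
  a + b < 30 → c * (L * L) + (a * (u * u) + b * (v * v)) < d * (u * v) * L
negative-below-product a b c d u v L w L+w≡uv c<d 6≤u u≤v 5v≤L a+b<30 = begin-strict
  c * (L * L) + (a * (u * u) + b * (v * v))  ≤⟨ +-monoʳ-≤ (c * (L * L)) (weighted-squares≤ a b u v u≤v) ⟩
  c * (L * L) + (a + b) * (v * v)            <⟨ +-monoʳ-< (c * (L * L)) (*-monoˡ-< (v * v) a+b<30) ⟩
  c * (L * L) + 30 * (v * v)                 ≡⟨ cong (c * (L * L) +_) (solve (v ∷ [])) ⟩
  c * (L * L) + (6 * v) * (5 * v)            ≤⟨ +-monoʳ-≤ (c * (L * L)) (*-mono-≤ (*-monoˡ-≤ v 6≤u) 5v≤L) ⟩
  c * (L * L) + (u * v) * L                  ≡⟨ cong (λ t → c * (L * L) + t * L) (sym L+w≡uv) ⟩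
  c * (L * L) + (L + w) * L                  ≤⟨ m≤m+n _ (c * w * L) ⟩
  c * (L * L) + (L + w) * L + c * w * L      ≡⟨ solve (c ∷ L ∷ w ∷ []) ⟩
  suc c * (L + w) * L                        ≡⟨ cong (λ t → suc c * t * L) L+w≡uv ⟩
  suc c * (u * v) * L                        ≤⟨ *-monoˡ-≤ L (*-monoˡ-≤ (u * v) c<d) ⟩
  d * (u * v) * L                            ∎
  where
  open ≤-Reasoning
  instance
    v²≢0 : NonZero (v * v)
    v²≢0 = square-nonZero (≤-trans (s≤s z≤n) (≤-trans 6≤u u≤v))

-- For c < d ≤ 5 c the larger root of c z² − d u v z + K lies between
-- B (i + j − 1) ≈ 0.97 u v and B (i + j) ≈ 5.66 u v.
Between : ℕ → ℕ → ℕ → ℕ → Set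
Between a b c d = c < d × d ≤ 5 * c × a + b + c < 6 * d × a + b < 30 × 1 ≤ a

between? : ∀ a b c d → Dec (Between a b c d)
between? a b c d = c <? d ×-dec d ≤? 5 * c ×-dec a + b + c <? 6 * d ×-dec a + b <? 30 ×-dec 1 ≤? a

no-solution-between : ∀ {a b c d} → Between a b c d → NoSolutionFrom 2 a b c d
no-solution-between {a} {b} {c} {d} (c<d , d≤5c , abc<6d , a+b<30 , 1≤a) {suc i} {suc j} {k}
  2≤i@(s≤s 1≤i) i≤j j≤k eq =
  no-balancing-root-dominated c (a * (u * u) + b * (v * v)) (d * (u * v)) j≤k (s≤s (m≤n+m j i))
    (negative-at-middle a b c d u v 6≤u u≤v abc<6d)
    (negative-below-product a b c d u v L (B i * B j) (B-addition i j) c<d 6≤u u≤v 5v≤L a+b<30)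
    (scale-shift-≤ c 5 d≤5c (B-product i j))
    (weighted-squares-positive a b u v 1≤a (≤-trans (s≤s z≤n) 6≤u))
    (quadratic-in-z a b c d u v (B k) eq)
  where
  u = B (suc i)
  v = B (suc j)
  L = B (suc i + j)
  6≤u : 6 ≤ u
  6≤u = B-mono-≤ 2≤i
  u≤v : u ≤ v
  u≤v = B-mono-≤ i≤j
  5v≤L : 5 * v ≤ L
  5v≤L = ≤-trans (B-growth (suc j)) (B-mono-≤ (s≤s (+-monoˡ-≤ j 1≤i)))

-- L + w v = u y is the addition formula B (i + j) + B (i − 1) B j = B i B (j + 1),
-- and y + x = 6 v the recurrence around B j.
negative-below-sixfold : ∀ a b c u v L w y x → L + w * v ≡ u * y → y + x ≡ 6 * v → 1 ≤ c → 1 ≤ w →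
  6 ≤ u → u ≤ v → 25 * v ≤ L → a + b < 25 → c * (L * L) + (a * (u * u) + b * (v * v)) < 6 * c * (u * v) * L
negative-below-sixfold a b c u v L w y x L+wv≡uy y+x≡6v 1≤c 1≤w 6≤u u≤v 25v≤L a+b<25 = begin-strict
  c * (L * L) + (a * (u * u) + b * (v * v))  ≤⟨ +-monoʳ-≤ (c * (L * L)) (weighted-squares≤ a b u v u≤v) ⟩
  c * (L * L) + (a + b) * (v * v)            <⟨ +-monoʳ-< (c * (L * L)) (*-monoˡ-< (v * v) a+b<25) ⟩
  c * (L * L) + 25 * (v * v)                 ≡⟨ cong (c * (L * L) +_) (solve (v ∷ [])) ⟩
  c * (L * L) + v * (25 * v)                 ≤⟨ +-monoʳ-≤ (c * (L * L)) (*-monoʳ-≤ v 25v≤L) ⟩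
  c * (L * L) + v * L                        ≡⟨ cong (c * (L * L) +_) (sym (*-identityˡ (v * L))) ⟩
  c * (L * L) + 1 * (v * L)                  ≤⟨ +-monoʳ-≤ (c * (L * L)) (*-monoˡ-≤ (v * L) (*-mono-≤ 1≤c 1≤w)) ⟩
  c * (L * L) + c * w * (v * L)              ≤⟨ m≤m+n _ (c * u * x * L) ⟩
  c * (L * L) + c * w * (v * L) + c * u * x * L  ≡⟨ solve (c ∷ L ∷ w ∷ v ∷ u ∷ x ∷ []) ⟩
  c * (L + w * v) * L + c * u * x * L        ≡⟨ cong (λ t → c * t * L + c * u * x * L) L+wv≡uy ⟩
  c * (u * y) * L + c * u * x * L            ≡⟨ solve (c ∷ u ∷ y ∷ x ∷ L ∷ []) ⟩
  c * u * (y + x) * L                        ≡⟨ cong (λ t → c * u * t * L) y+x≡6v ⟩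
  c * u * (6 * v) * L                        ≡⟨ solve (c ∷ u ∷ v ∷ L ∷ []) ⟩
  6 * c * (u * v) * L                        ∎
  where
  open ≤-Reasoning
  instance
    v²≢0 : NonZero (v * v)
    v²≢0 = square-nonZero (≤-trans (s≤s z≤n) (≤-trans 6≤u u≤v))

-- For d = 6 c the larger root lies between B (i + j) ≈ 5.66 u v and B (i + j + 1).
Sixfold : ℕ → ℕ → ℕ → ℕ → Set
Sixfold a b c d = d ≡ 6 * c × 1 ≤ c × a + b + c < 6 * d × a + b < 25 × 1 ≤ a

sixfold? : ∀ a b c d → Dec (Sixfold a b c d)
sixfold? a b c d = d ≟ 6 * c ×-dec 1 ≤? c ×-dec a + b + c <? 6 * d ×-dec a + b <? 25 ×-dec 1 ≤? a

no-solution-sixfold : ∀ {a b c d} → Sixfold a b c d → NoSolutionFrom 2 a b c d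
no-solution-sixfold {a} {b} {c} (refl , 1≤c , abc<6d , a+b<25 , 1≤a) {suc i} {suc j} {k}
  2≤i@(s≤s 1≤i) i≤j j≤k eq =
  no-balancing-root-dominated c (a * (u * u) + b * (v * v)) (6 * c * (u * v)) j≤k (m≤n+m (suc j) (suc i))
    (negative-at-middle a b c (6 * c) u v 6≤u u≤v abc<6d)
    (negative-below-sixfold a b c u v L (B i) (B (suc (suc j))) (B j) (B-addition i (suc j)) (B-recurrence j)
      1≤c (B-mono-≤ 1≤i) 6≤u u≤v 25v≤L a+b<25)
    (scale-shift-≤ c 6 ≤-refl 6uv≤U)
    (weighted-squares-positive a b u v 1≤a (≤-trans (s≤s z≤n) 6≤u))
    (quadratic-in-z a b c (6 * c) u v (B k) eq)
  where
  open ≤-Reasoning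
  u = B (suc i)
  v = B (suc j)
  L = B (suc i + suc j)
  6≤u : 6 ≤ u
  6≤u = B-mono-≤ 2≤i
  u≤v : u ≤ v
  u≤v = B-mono-≤ i≤j
  25v≤L : 25 * v ≤ L
  25v≤L = begin
    25 * v                  ≡⟨ *-assoc 5 5 v ⟩
    5 * (5 * v)             ≤⟨ *-monoʳ-≤ 5 (B-growth (suc j)) ⟩
    5 * B (suc (suc j))     ≤⟨ B-growth (suc (suc j)) ⟩
    B (suc (suc (suc j)))   ≤⟨ B-mono-≤ (+-monoˡ-≤ (suc j) 2≤i) ⟩
    L                       ∎
  6uv≤U : 6 * (u * v) ≤ B (suc (suc i + suc j))
  6uv≤U = begin
    6 * (u * v)               ≤⟨ *-monoˡ-≤ (u * v) (from-yes (6 ≤? 25)) ⟩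
    25 * (u * v)              ≡⟨ *-assoc 5 5 (u * v) ⟩
    5 * (5 * (u * v))         ≤⟨ *-monoʳ-≤ 5 (B-product i j) ⟩
    5 * B (suc (suc i + j))   ≡⟨ cong (λ t → 5 * B t) (sym (+-suc (suc i) j)) ⟩
    5 * L                     ≤⟨ B-growth (suc i + suc j) ⟩
    B (suc (suc i + suc j))   ∎

-- w₁ and w₂ are B (i − 1) and B (j − 1), so 36 w₁ w₂ ≥ u v: the correction term of the
-- addition formula is large enough once u ≥ 35.
negative-below-product-diagonal : ∀ a b c u v L w₁ w₂ → L + w₁ * w₂ ≡ u * v → u ≤ 6 * w₁ → v ≤ 6 * w₂ →
  35 ≤ u → u ≤ v → 5 * v ≤ L → 1 ≤ c → a + b ≤ 4 → c * (L * L) + (a * (u * u) + b * (v * v)) < c * (u * v) * L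
negative-below-product-diagonal a b c u v L w₁ w₂ L+w≡uv u≤6w₁ v≤6w₂ 35≤u u≤v 5v≤L 1≤c a+b≤4 = begin-strict
  c * (L * L) + K                  <⟨ +-monoʳ-< (c * (L * L)) (*-cancelˡ-< 36 K (w₁ * w₂ * L) 36K<) ⟩
  c * (L * L) + w₁ * w₂ * L        ≡⟨ cong (c * (L * L) +_) (sym (*-identityˡ (w₁ * w₂ * L))) ⟩
  c * (L * L) + 1 * (w₁ * w₂ * L)  ≤⟨ +-monoʳ-≤ (c * (L * L)) (*-monoˡ-≤ (w₁ * w₂ * L) 1≤c) ⟩
  c * (L * L) + c * (w₁ * w₂ * L)  ≡⟨ solve (c ∷ L ∷ w₁ ∷ w₂ ∷ []) ⟩
  c * (L + w₁ * w₂) * L            ≡⟨ cong (λ t → c * t * L) L+w≡uv ⟩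
  c * (u * v) * L                  ∎
  where
  open ≤-Reasoning
  K = a * (u * u) + b * (v * v)
  instance
    v²≢0 : NonZero (v * v)
    v²≢0 = square-nonZero (≤-trans (s≤s z≤n) (≤-trans 35≤u u≤v))
  36K< : 36 * K < 36 * (w₁ * w₂ * L)
  36K< = begin-strict
    36 * K                       ≤⟨ *-monoʳ-≤ 36 (weighted-squares≤ a b u v u≤v) ⟩
    36 * ((a + b) * (v * v))     ≤⟨ *-monoʳ-≤ 36 (*-monoˡ-≤ (v * v) a+b≤4) ⟩
    36 * (4 * (v * v))           ≡⟨ solve (v ∷ []) ⟩
    144 * (v * v)                <⟨ *-monoˡ-< (v * v) (from-yes (144 <? 175)) ⟩
    175 * (v * v)                ≡⟨ solve (v ∷ []) ⟩
    (35 * v) * (5 * v)           ≤⟨ *-mono-≤ (*-monoˡ-≤ v 35≤u) 5v≤L ⟩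
    (u * v) * L                  ≤⟨ *-monoˡ-≤ L (*-mono-≤ u≤6w₁ v≤6w₂) ⟩
    (6 * w₁) * (6 * w₂) * L      ≡⟨ solve (w₁ ∷ w₂ ∷ L ∷ []) ⟩
    36 * (w₁ * w₂ * L)           ∎

-- For d = c the larger root is just below u v, between B (i + j − 1) and B (i + j);
-- the margin is only wide enough from i = 3 on.
no-solution-diagonal : ∀ {a b c} → 1 ≤ a → a + b ≤ 4 → a + b + c < 6 * c → NoSolutionFrom 3 a b c c
no-solution-diagonal {a} {b} {c} 1≤a a+b≤4 abc<6c {suc i} {suc j} {k} 3≤i@(s≤s 2≤i) i≤j@(s≤s i≤j′) j≤k eq =
  no-balancing-root-dominated c (a * (u * u) + b * (v * v)) (c * (u * v)) j≤k (s≤s (m≤n+m j i))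
    (negative-at-middle a b c c u v 6≤u u≤v abc<6c)
    (negative-below-product-diagonal a b c u v L (B i) (B j) (B-addition i j) (B-suc≤6*B 1≤i)
      (B-suc≤6*B (≤-trans 1≤i i≤j′)) 35≤u u≤v 5v≤L (<-*⇒1≤ 6 abc<6c) a+b≤4)
    (*-monoʳ-≤ c (≤-trans (m≤n*m (u * v) 5) (B-product i j)))
    (weighted-squares-positive a b u v 1≤a (≤-trans (s≤s z≤n) 6≤u))
    (quadratic-in-z a b c c u v (B k) eq)
  where
  u = B (suc i)
  v = B (suc j)
  L = B (suc i + j)
  1≤i : 1 ≤ i
  1≤i = ≤-trans (s≤s z≤n) 2≤i
  35≤u : 35 ≤ u
  35≤u = B-mono-≤ 3≤i
  6≤u : 6 ≤ u
  6≤u = ≤-trans (from-yes (6 ≤? 35)) 35≤u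
  u≤v : u ≤ v
  u≤v = B-mono-≤ i≤j
  5v≤L : 5 * v ≤ L
  5v≤L = ≤-trans (B-growth (suc j)) (B-mono-≤ (s≤s (+-monoˡ-≤ j 1≤i)))

scaled-invariant : ∀ c K x v → x * x + v * v ≡ 6 * x * v + 1 →
  c * (x * x) + K + c * (v * v) ≡ c * (6 * v) * x + (c + K)
scaled-invariant c K x v invariant = begin
  c * (x * x) + K + c * (v * v)  ≡⟨ solve (c ∷ K ∷ x ∷ v ∷ []) ⟩
  c * (x * x + v * v) + K        ≡⟨ cong (λ t → c * t + K) invariant ⟩
  c * (6 * x * v + 1) + K        ≡⟨ solve (c ∷ K ∷ x ∷ v ∷ []) ⟩
  c * (6 * v) * x + (c + K)      ∎
  where open ≡-Reasoning

-- With i = 2 and d = c the larger root is 3 v + √(9 v² − (K / c)), to be compared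
-- with B (j + 1) = 3 v + √(8 v² + 1): the sign of c v² − (c + K) decides the window.
no-solution-at-2-root<B-suc : ∀ a b c {j k} → 2 ≤ j → j ≤ k → a + b + c < 6 * c →
  c * (B j * B j) < c + (a * 36 + b * (B j * B j)) → ¬ Solves a b c c 6 (B j) (B k)
no-solution-at-2-root<B-suc a b c {j} {k} 2≤j j≤k abc<6c cv²<c+K eq =
  no-balancing-root c K (c * (6 * v)) j≤k ≤-refl negative negative positive
    (*-monoʳ-≤ c (6*B≤B-suc+B-suc j)) (quadratic-in-z a b c c 6 v (B k) eq)
  where
  open ≤-Reasoning
  v = B j
  U = B (suc j)
  K = a * 36 + b * (v * v)
  negative : c * (v * v) + K < c * (6 * v) * v
  negative = negative-at-middle a b c c 6 v ≤-refl (B-mono-≤ 2≤j) abc<6c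
  positive : c * (6 * v) * U < c * (U * U) + K
  positive = +-cancelʳ-< (c * (v * v)) _ _ (begin-strict
    c * (6 * v) * U + c * (v * v)  <⟨ +-monoʳ-< (c * (6 * v) * U) cv²<c+K ⟩
    c * (6 * v) * U + (c + K)      ≡⟨ sym (scaled-invariant c K U v (B-invariant j)) ⟩
    c * (U * U) + K + c * (v * v)  ∎)

no-solution-at-2-B-suc<root : ∀ a b c {j k} → 2 ≤ j → j ≤ k → a + b + c < 6 * c → 1 ≤ a →
  c + (a * 36 + b * (B j * B j)) < c * (B j * B j) → ¬ Solves a b c c 6 (B j) (B k)
no-solution-at-2-B-suc<root a b c {j} {k} 2≤j j≤k abc<6c 1≤a c+K<cv² eq =
  no-balancing-root-dominated c K (c * (6 * v)) j≤k (n≤1+n j)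
    (negative-at-middle a b c c 6 v ≤-refl (B-mono-≤ 2≤j) abc<6c) negative
    (*-monoʳ-≤ c (6*B≤B-suc-suc j)) (weighted-squares-positive a b 6 v 1≤a (s≤s z≤n))
    (quadratic-in-z a b c c 6 v (B k) eq)
  where
  open ≤-Reasoning
  v = B j
  L = B (suc j)
  K = a * 36 + b * (v * v)
  negative : c * (L * L) + K < c * (6 * v) * L
  negative = +-cancelʳ-< (c * (v * v)) _ _ (begin-strict
    c * (L * L) + K + c * (v * v)  ≡⟨ scaled-invariant c K L v (B-invariant j) ⟩
    c * (6 * v) * L + (c + K)      <⟨ +-monoʳ-< (c * (6 * v) * L) c+K<cv² ⟩
    c * (6 * v) * L + c * (v * v)  ∎)

diagonal-from-2 : ∀ {c} → (∀ {j k} → 2 ≤ j → j ≤ k → ¬ Solves 1 1 c c 6 (B j) (B k)) →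
  1 + 1 + c < 6 * c → NoSolutionFrom 2 1 1 c c
diagonal-from-2 _ _ {suc zero} (s≤s ())
diagonal-from-2 at-2 _ {suc (suc zero)} _ 2≤j j≤k = at-2 2≤j j≤k
diagonal-from-2 {c} _ 2+c<6c {suc (suc (suc i))} _ =
  no-solution-diagonal {1} {1} {c} (s≤s z≤n) (from-yes (2 ≤? 4)) 2+c<6c (s≤s (s≤s (s≤s z≤n)))

-- The shape of c + K < c v² for a = b = 1 and u = B 2 = 6.
dominates-square : ∀ c s → 1 + c + 36 < c * s → 1 + c + (1 * 36 + 1 * s) < (1 + c) * s
dominates-square c s h = begin-strict
  1 + c + (1 * 36 + 1 * s)  ≡⟨ solve (c ∷ s ∷ []) ⟩
  1 + c + 36 + s            <⟨ +-monoˡ-< s h ⟩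
  c * s + s                 ≡⟨ solve (c ∷ s ∷ []) ⟩
  (1 + c) * s               ∎
  where open ≤-Reasoning

no-solution-1111-at-2 : ∀ {j k} → 2 ≤ j → j ≤ k → ¬ Solves 1 1 1 1 6 (B j) (B k)
no-solution-1111-at-2 {j} 2≤j j≤k =
  no-solution-at-2-root<B-suc 1 1 1 2≤j j≤k (from-yes (3 <? 6)) (m<n+m (1 * (B j * B j)) {37} z<s)

no-solution-1122-at-2 : ∀ {j k} → 2 ≤ j → j ≤ k → ¬ Solves 1 1 2 2 6 (B j) (B k)
no-solution-1122-at-2 {suc zero} (s≤s ())
no-solution-1122-at-2 {suc (suc zero)} 2≤j j≤k =
  no-solution-at-2-root<B-suc 1 1 2 2≤j j≤k (from-yes (4 <? 12)) (from-yes (72 <? 74))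
no-solution-1122-at-2 {suc (suc (suc j))} 2≤j j≤k =
  no-solution-at-2-B-suc<root 1 1 2 2≤j j≤k (from-yes (4 <? 12)) (s≤s z≤n)
    (dominates-square 1 (v * v) (<-≤-trans (from-yes (38 <? 1225)) (*-monoʳ-≤ 1 1225≤v²)))
  where
  v = B (suc (suc (suc j)))
  35≤v : 35 ≤ v
  35≤v = B-mono-≤ {3} {suc (suc (suc j))} (s≤s (s≤s (s≤s z≤n)))
  1225≤v² : 1225 ≤ v * v
  1225≤v² = *-mono-≤ 35≤v 35≤v

no-solution-1155-at-2 : ∀ {j k} → 2 ≤ j → j ≤ k → ¬ Solves 1 1 5 5 6 (B j) (B k)
no-solution-1155-at-2 {j} 2≤j j≤k =
  no-solution-at-2-B-suc<root 1 1 5 2≤j j≤k (from-yes (7 <? 30)) (s≤s z≤n)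
    (dominates-square 4 (B j * B j) (<-≤-trans (from-yes (41 <? 144)) (*-monoʳ-≤ 4 (36≤B*B 2≤j))))

-- Reduction to sorted indices

Ones : ℕ → ℕ → ℕ → Set
Ones i j k = (B i ≡ 1) × (B j ≡ 1) × (B k ≡ 1)

Sorted : ℕ → ℕ → ℕ → ℕ → Set
Sorted a b c d = ∀ {i j k} → 1 ≤ i → i ≤ j → j ≤ k → Solves a b c d (B i) (B j) (B k) → Ones i j k

sorted : ∀ {a b c d} → LowConditions a b c d → NoSolutionFrom 2 a b c d → Sorted a b c d
sorted low _ {suc zero} {suc zero} _ _ 1≤k eq = refl , refl , Solves-1-1⇒B≡1 low 1≤k eq
sorted low _ {suc zero} {suc (suc j)} _ _ j≤k eq = ⊥-elim (Solves-1⇒⊥ low (s≤s (s≤s z≤n)) j≤k eq)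
sorted _ from-2 {suc (suc i)} _ i≤j j≤k eq = ⊥-elim (from-2 (s≤s (s≤s z≤n)) i≤j j≤k eq)

sorted-between : ∀ a b c d {_ : True (low-conditions? a b c d)} {_ : True (between? a b c d)} → Sorted a b c d
sorted-between a b c d {low} {between} = sorted (toWitness low) (no-solution-between (toWitness between))

sorted-sixfold : ∀ a b c d {_ : True (low-conditions? a b c d)} {_ : True (sixfold? a b c d)} → Sorted a b c d
sorted-sixfold a b c d {low} {sixfold} = sorted (toWitness low) (no-solution-sixfold (toWitness sixfold))

sorted-diagonal : ∀ c {_ : True (low-conditions? 1 1 c c)} {_ : True (1 + 1 + c <? 6 * c)} →
  (∀ {j k} → 2 ≤ j → j ≤ k → ¬ Solves 1 1 c c 6 (B j) (B k)) → Sorted 1 1 c c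
sorted-diagonal c {low} {2+c<6c} at-2 = sorted (toWitness low) (diagonal-from-2 at-2 (toWitness 2+c<6c))

Solves-swap₁₂ : ∀ a b c d x y z → Solves a b c d x y z → Solves b a c d y x z
Solves-swap₁₂ a b c d x y z eq = begin
  b * (y * y) + a * (x * x) + c * (z * z)  ≡⟨ solve (a ∷ b ∷ c ∷ x ∷ y ∷ z ∷ []) ⟩
  a * (x * x) + b * (y * y) + c * (z * z)  ≡⟨ eq ⟩
  d * (x * y * z)                          ≡⟨ solve (d ∷ x ∷ y ∷ z ∷ []) ⟩
  d * (y * x * z)                          ∎
  where open ≡-Reasoning

Solves-swap₂₃ : ∀ a b c d x y z → Solves a b c d x y z → Solves a c b d x z y
Solves-swap₂₃ a b c d x y z eq = begin
  a * (x * x) + c * (z * z) + b * (y * y)  ≡⟨ solve (a ∷ b ∷ c ∷ x ∷ y ∷ z ∷ []) ⟩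
  a * (x * x) + b * (y * y) + c * (z * z)  ≡⟨ eq ⟩
  d * (x * y * z)                          ≡⟨ solve (d ∷ x ∷ y ∷ z ∷ []) ⟩
  d * (x * z * y)                          ∎
  where open ≡-Reasoning

Solves-swap₁₃ : ∀ a b c d x y z → Solves a b c d x y z → Solves c b a d z y x
Solves-swap₁₃ a b c d x y z eq = begin
  c * (z * z) + b * (y * y) + a * (x * x)  ≡⟨ solve (a ∷ b ∷ c ∷ x ∷ y ∷ z ∷ []) ⟩
  a * (x * x) + b * (y * y) + c * (z * z)  ≡⟨ eq ⟩
  d * (x * y * z)                          ≡⟨ solve (d ∷ x ∷ y ∷ z ∷ []) ⟩
  d * (z * y * x)                          ∎
  where open ≡-Reasoning

module _ {P Q R : Set} where
  swap₁₂ : Q × P × R → P × Q × R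
  swap₁₂ (q , p , r) = p , q , r

  swap₂₃ : P × R × Q → P × Q × R
  swap₂₃ (p , r , q) = p , q , r

  swap₁₃ : R × Q × P → P × Q × R
  swap₁₃ (r , q , p) = p , q , r

MaxLast : ℕ → ℕ → ℕ → ℕ → Set
MaxLast a b c d = ∀ {i j k} → 1 ≤ i → 1 ≤ j → i ≤ k → j ≤ k → Solves a b c d (B i) (B j) (B k) → Ones i j k

max-last : ∀ a b c d → Sorted a b c d → Sorted b a c d → MaxLast a b c d
max-last a b c d abc bac {i} {j} {k} 1≤i 1≤j i≤k j≤k eq with ≤-total i j
... | inj₁ i≤j = abc 1≤i i≤j j≤k eq
... | inj₂ j≤i = swap₁₂ (bac 1≤j j≤i i≤k (Solves-swap₁₂ a b c d (B i) (B j) (B k) eq))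

Holds : ℕ → ℕ → ℕ → ℕ → Set
Holds a b c d = ∀ i j k → i ≥ 1 → j ≥ 1 → k ≥ 1 → Solves a b c d (B i) (B j) (B k) → Ones i j k

holds : ∀ a b c d → MaxLast a b c d → MaxLast a c b d → MaxLast c b a d → Holds a b c d
holds a b c d abc acb cba i j k 1≤i 1≤j 1≤k eq with ≤-total i j
... | inj₁ i≤j with ≤-total j k
...   | inj₁ j≤k = abc 1≤i 1≤j (≤-trans i≤j j≤k) j≤k eq
...   | inj₂ k≤j = swap₂₃ (acb 1≤i 1≤k i≤j k≤j (Solves-swap₂₃ a b c d (B i) (B j) (B k) eq))
holds a b c d abc acb cba i j k 1≤i 1≤j 1≤k eq | inj₂ j≤i with ≤-total i k
...   | inj₁ i≤k = abc 1≤i 1≤j i≤k (≤-trans j≤i i≤k) eq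
...   | inj₂ k≤i = swap₁₃ (cba 1≤k 1≤j k≤i j≤i (Solves-swap₁₃ a b c d (B i) (B j) (B k) eq))

holds-of-sorted : ∀ a b c d → Sorted a b c d → Sorted b a c d → Sorted a c b d → Sorted c a b d →
  Sorted c b a d → Sorted b c a d → Holds a b c d
holds-of-sorted a b c d abc bac acb cab cba bca =
  holds a b c d (max-last a b c d abc bac) (max-last a c b d acb cab) (max-last c b a d cba bca)

theorem4 : ∀ (a b c d : ℕ) → (a , b , c , d) ∈ coeffTuples →
    ∀ (i j k : ℕ) → i ≥ 1 → j ≥ 1 → k ≥ 1 →
    a * (B i * B i) + b * (B j * B j) + c * (B k * B k) ≡ d * (B i * B j * B k) →
    (B i ≡ 1) × (B j ≡ 1) × (B k ≡ 1)
theorem4 .1 .1 .1 .1 (here refl) = holds-of-sorted 1 1 1 1 s s s s s s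
  where s = sorted-diagonal 1 no-solution-1111-at-2
theorem4 .1 .1 .1 .3 (there (here refl)) = holds-of-sorted 1 1 1 3 s s s s s s
  where s = sorted-between 1 1 1 3
theorem4 .1 .1 .2 .2 (there (there (here refl))) =
  holds-of-sorted 1 1 2 2 s₁₁₂ s₁₁₂ s₁₂₁ s₂₁₁ s₂₁₁ s₁₂₁
  where
  s₁₁₂ = sorted-diagonal 2 no-solution-1122-at-2
  s₁₂₁ = sorted-between 1 2 1 2
  s₂₁₁ = sorted-between 2 1 1 2
theorem4 .1 .1 .2 .4 (there (there (there (here refl)))) =
  holds-of-sorted 1 1 2 4 (sorted-between 1 1 2 4) (sorted-between 1 1 2 4) (sorted-between 1 2 1 4)
    (sorted-between 2 1 1 4) (sorted-between 2 1 1 4) (sorted-between 1 2 1 4)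
theorem4 .1 .1 .5 .5 (there (there (there (there (here refl))))) =
  holds-of-sorted 1 1 5 5 (sorted-diagonal 5 no-solution-1155-at-2) (sorted-diagonal 5 no-solution-1155-at-2)
    (sorted-between 1 5 1 5) (sorted-between 5 1 1 5) (sorted-between 5 1 1 5) (sorted-between 1 5 1 5)
theorem4 .1 .2 .3 .6 (there (there (there (there (there (here refl)))))) =
  holds-of-sorted 1 2 3 6 (sorted-between 1 2 3 6) (sorted-between 2 1 3 6) (sorted-between 1 3 2 6)
    (sorted-between 3 1 2 6) (sorted-sixfold 3 2 1 6) (sorted-sixfold 2 3 1 6)
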